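{- For every proposition symbol $x$ and every PLTL formula $W$, the number of PLTL-clauses generated by the translation $\tau_1[\Box(x\Rightarrow W)]$ (i.e. the number of conjuncts $\Box A_i$ in its final result) is at most $11\cdot\mathrm{len}(W)$.
   Context: PLTL formulae are built from proposition symbols, $\mathbf{true}$, $\mathbf{false}$, $\neg,\vee,\wedge,\Rightarrow$ and temporal operators $\bigcirc$ (next), $\Diamond$ (sometime), $\Box$ (always), $\mathcal{U}$ (until), $\mathcal{W}$ (unless); $\mathbf{start}$ is a nullary connective true only at the first moment. A literal is a proposition symbol or its negation. A PLTL-clause is $\mathbf{start}\Rightarrow\bigvee_c l_c$, $\bigwedge_a k_a\Rightarrow\bigcirc\bigvee_d l_d$ or $\bigwedge_b k_b\Rightarrow\Diamond l$ with all $k,l$ literals. $\tau_1$, applied to $\Box(x\Rightarrow W)$ ($x$ a proposition symbol), is computed by applying the following rewrite rules repeatedly until the result is a conjunction of formulae $\Box A_i$, each $A_i$ a PLTL-clause (write $\tau_1[x\Rightarrow A]$ for $\tau_1[\Box(x\Rightarrow A)]$; $y,z,v$ are proposition symbols new at each application; $l,m,l_i$ literals; $\neg\mathbf{true}$, $\neg\mathbf{false}$ rewritten to $\mathbf{false}$, $\mathbf{true}$). (1) $x\Rightarrow(A\wedge B)\mapsto\tau_1[x\Rightarrow A]\wedge\tau_1[x\Rightarrow B]$; $x\Rightarrow(A\Rightarrow B)\mapsto\tau_1[x\Rightarrow\neg A\vee B]$; $x\Rightarrow\neg(A\wedge B)\mapsto\tau_1[x\Rightarrow\neg A\vee\neg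 B]$; $x\Rightarrow\neg(A\Rightarrow B)\mapsto\tau_1[x\Rightarrow A]\wedge\tau_1[x\Rightarrow\neg B]$; $x\Rightarrow\neg(A\vee B)\mapsto\tau_1[x\Rightarrow\neg A]\wedge\tau_1[x\Rightarrow\neg B]$. (2) $x\Rightarrow\bigcirc A\mapsto\Box(x\Rightarrow\bigcirc y)\wedge\tau_1[y\Rightarrow A]$ if $A$ is neither a literal nor a disjunction of literals; $x\Rightarrow\neg\bigcirc A\mapsto\Box(x\Rightarrow\bigcirc y)\wedge\tau_1[y\Rightarrow\neg A]$; $x\Rightarrow\Box A\mapsto\tau_1[x\Rightarrow\Box y]\wedge\tau_1[y\Rightarrow A]$ ($A$ not a literal); $x\Rightarrow\neg\Box A\mapsto\Box(x\Rightarrow\Diamond y)\wedge\tau_1[y\Rightarrow\neg A]$; $x\Rightarrow\Diamond A\mapsto\Box(x\Rightarrow\Diamond y)\wedge\tau_1[y\Rightarrow A]$ ($A$ not a literal); $x\Rightarrow\neg\Diamond A\mapsto\tau_1[x\Rightarrow\Box y]\wedge\tau_1[y\Rightarrow\neg A]$; $x\Rightarrow A\,\mathcal{U}\,B\mapsto\tau_1[x\Rightarrow y\,\mathcal{U}\,B]\wedge\tau_1[y\Rightarrow A]$ ($A$ not a literal), $\mapsto\tau_1[x\Rightarrow A\,\mathcal{U}\,y]\wedge\tau_1[y\Rightarrow B]$ ($B$ not a literal); the same with $\mathcal{W}$ for $\mathcal{U}$; $x\Rightarrow\neg(A\,\mathcal{U}\,B)\mapsto\tau_1[x\Rightarrow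 y\,\mathcal{W}\,v]\wedge\tau_1[y\Rightarrow\neg B]\wedge\tau_1[v\Rightarrow(y\wedge z)]\wedge\tau_1[z\Rightarrow\neg A]$; $x\Rightarrow\neg(A\,\mathcal{W}\,B)\mapsto\tau_1[x\Rightarrow y\,\mathcal{U}\,v]\wedge\tau_1[y\Rightarrow\neg B]\wedge\tau_1[v\Rightarrow(y\wedge z)]\wedge\tau_1[z\Rightarrow\neg A]$. (3) $x\Rightarrow\Box l\mapsto\tau_1[x\Rightarrow l]\wedge\tau_1[x\Rightarrow y]\wedge\Box(y\Rightarrow\bigcirc l)\wedge\Box(y\Rightarrow\bigcirc y)$; $x\Rightarrow l\,\mathcal{U}\,m\mapsto\Box(x\Rightarrow\Diamond m)\wedge\tau_1[x\Rightarrow l\vee m]\wedge\tau_1[x\Rightarrow y\vee m]\wedge\Box(y\Rightarrow\bigcirc(l\vee m))\wedge\Box(y\Rightarrow\bigcirc(y\vee m))$; $x\Rightarrow l\,\mathcal{W}\,m\mapsto$ the same without $\Box(x\Rightarrow\Diamond m)$. (4) $x\Rightarrow D\vee A\mapsto\tau_1[x\Rightarrow D\vee y]\wedge\tau_1[y\Rightarrow A]$, $D$ a disjunction, $A$ neither a literal nor a disjunction of literals. (5) $x\Rightarrow D\mapsto\Box(\mathbf{start}\Rightarrow\neg x\vee D)\wedge\Box(\mathbf{true}\Rightarrow\bigcirc(\neg x\vee D))$ for $D$ a literal or disjunction of literals; $x\Rightarrow\mathbf{true}\mapsto\Box(\mathbf{start}\Rightarrow\mathbf{true})\wedge\Box(\mathbf{true}\Rightarrow\bigcirc\mathbf{true})$;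 $x\Rightarrow\mathbf{false}\mapsto\Box(\mathbf{start}\Rightarrow\neg x)\wedge\Box(\mathbf{true}\Rightarrow\bigcirc\neg x)$; $\tau_1[x\Rightarrow\Diamond l]=\Box(x\Rightarrow\Diamond l)$; $\tau_1[x\Rightarrow\bigcirc(l_1\vee\dots\vee l_n)]=\Box(x\Rightarrow\bigcirc(l_1\vee\dots\vee l_n))$. Length: $\mathrm{len}(\Diamond l)=1$; $\mathrm{len}(l_1\vee\dots\vee l_n)=1$ ($n\ge1$); $\mathrm{len}(c)=1$ for $c\in\{\mathbf{true},\neg\mathbf{true},\mathbf{false},\neg\mathbf{false}\}$; $\mathrm{len}(\bigcirc(l_1\vee\dots\vee l_n))=1$; $\mathrm{len}(\neg\Box A)=\mathrm{len}(\neg\Diamond A)=\mathrm{len}(\neg\bigcirc A)=1+\mathrm{len}(\neg A)$; $\mathrm{len}(\Box A)=1+\mathrm{len}(A)$; $\mathrm{len}(\Diamond A)=1+\mathrm{len}(A)$ ($A$ not a literal); $\mathrm{len}(\bigcirc A)=1+\mathrm{len}(A)$ ($A$ not a disjunction of literals); for $\circ\in\{\mathcal{U},\mathcal{W},\vee,\wedge\}$: $\mathrm{len}(\neg(A\circ B))=1+\mathrm{len}(\neg A)+\mathrm{len}(\neg B)$ and $\mathrm{len}(A\circ B)=1+\mathrm{len}(A)+\mathrm{len}(B)$ (for $\vee$: $A,B$ not disjunctions of literals); $\mathrm{len}(\neg(A\Rightarrow B))=1+\mathrm{len}(A)+\mathrm{len}(\neg B)$; $\mathrm{len}(A\Rightarrow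 B)=1+\mathrm{len}(\neg A)+\mathrm{len}(B)$. -}

module Defs where

open import Data.Nat using (ℕ; zero; suc; _+_)
open import Data.List using (List; []; _∷_; _++_; [_])
open import Data.Maybe using (Maybe; just; nothing)
open import Data.Unit using (⊤)
open import Data.Product using (_×_)
open import Relation.Binary.PropositionalEquality using (_≡_)

-- Proposition symbols: the symbols of the input (orig) and the fresh
-- symbols introduced by τ₁ (new k), drawn from a counter.

data Sym : Set where
  orig : ℕ → Sym
  new  : ℕ → Sym

infixr 4 _⇒ᶠ_
infixr 5 _∨ᶠ_
infixr 6 _∧ᶠ_
infix  7 _𝒰_ _𝒲_
infix  8 ~_ ○_ □_ ◇_

data Fm : Set where
  atom : Sym → Fm
  ⊤ᶠ ⊥ᶠ : Fm
  ~_ : Fm → Fm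
  _∨ᶠ_ _∧ᶠ_ _⇒ᶠ_ : Fm → Fm → Fm
  ○_ □_ ◇_ : Fm → Fm
  _𝒰_ _𝒲_ : Fm → Fm → Fm

Orig : Fm → Set
Orig (atom (orig _)) = ⊤
Orig (atom (new _))  = Data.Empty.⊥ where import Data.Empty
Orig ⊤ᶠ = ⊤
Orig ⊥ᶠ = ⊤
Orig (~ A) = Orig A
Orig (A ∨ᶠ B) = Orig A × Orig B
Orig (A ∧ᶠ B) = Orig A × Orig B
Orig (A ⇒ᶠ B) = Orig A × Orig B
Orig (○ A) = Orig A
Orig (□ A) = Orig A
Orig (◇ A) = Orig A
Orig (A 𝒰 B) = Orig A × Orig B
Orig (A 𝒲 B) = Orig A × Orig B

neg : Fm → Fm
neg (~ A) = A
neg ⊤ᶠ = ⊥ᶠ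
neg ⊥ᶠ = ⊤ᶠ
neg A = ~ A

simp : Fm → Fm
simp (atom s) = atom s
simp ⊤ᶠ = ⊤ᶠ
simp ⊥ᶠ = ⊥ᶠ
simp (~ A) = neg (simp A)
simp (A ∨ᶠ B) = simp A ∨ᶠ simp B
simp (A ∧ᶠ B) = simp A ∧ᶠ simp B
simp (A ⇒ᶠ B) = simp A ⇒ᶠ simp B
simp (○ A) = ○ simp A
simp (□ A) = □ simp A
simp (◇ A) = ◇ simp A
simp (A 𝒰 B) = simp A 𝒰 simp B
simp (A 𝒲 B) = simp A 𝒲 simp B

data Lit : Set where
  pos : Sym → Lit
  ngt : Sym → Lit

lit : Fm → Maybe Lit
lit (atom s) = just (pos s)
lit (~ atom s) = just (ngt s)
lit _ = nothing

ldisj : Fm → Maybe (List Lit)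
ldisj (A ∨ᶠ B) with ldisj A | ldisj B
... | just as | just bs = just (as ++ bs)
... | _ | _ = nothing
ldisj A with lit A
... | just l = just [ l ]
... | nothing = nothing

-- PLTL-clauses (each stands for □ of the clause)

data Rhs : Set where
  lits : List Lit → Rhs
  ⊤ʳ   : Rhs

data Clause : Set where
  initC : Rhs → Clause                -- start ⇒ R
  stepC : List Lit → Rhs → Clause     -- ⋀ ks ⇒ ○ R   ([] = true)
  evC   : List Lit → Lit → Clause     -- ⋀ ks ⇒ ◇ l

-- The translation τ₁ as the rewrite relation.
-- T k x A k' cs : rewriting □(x ⇒ A) to completion, with fresh symbols
-- taken as new k, new (k+1), ..., yields the clauses cs, and the next
-- unused fresh index is k'.  Where several rules apply, any may be used.

data T : ℕ → Sym → Fm → ℕ → List Clause → Set where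
  r-and  : ∀ {k k₁ k₂ x A B c₁ c₂} →
           T k x A k₁ c₁ → T k₁ x B k₂ c₂ → T k x (A ∧ᶠ B) k₂ (c₁ ++ c₂)
  r-imp  : ∀ {k k' x A B c} →
           T k x (neg A ∨ᶠ B) k' c → T k x (A ⇒ᶠ B) k' c
  r-nand : ∀ {k k' x A B c} →
           T k x (neg A ∨ᶠ neg B) k' c → T k x (~ (A ∧ᶠ B)) k' c
  r-nimp : ∀ {k k₁ k₂ x A B c₁ c₂} →
           T k x A k₁ c₁ → T k₁ x (neg B) k₂ c₂ → T k x (~ (A ⇒ᶠ B)) k₂ (c₁ ++ c₂)
  r-nor  : ∀ {k k₁ k₂ x A B c₁ c₂} →
           T k x (neg A) k₁ c₁ → T k₁ x (neg B) k₂ c₂ → T k x (~ (A ∨ᶠ B)) k₂ (c₁ ++ c₂)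
  r-next  : ∀ {k k' x A c} → ldisj A ≡ nothing →
            T (suc k) (new k) A k' c →
            T k x (○ A) k' (stepC [ pos x ] (lits [ pos (new k) ]) ∷ c)
  r-nnext : ∀ {k k' x A c} →
            T (suc k) (new k) (neg A) k' c →
            T k x (~ ○ A) k' (stepC [ pos x ] (lits [ pos (new k) ]) ∷ c)
  r-box   : ∀ {k k₁ k₂ x A c₁ c₂} → lit A ≡ nothing →
            T (suc k) x (□ atom (new k)) k₁ c₁ → T k₁ (new k) A k₂ c₂ →
            T k x (□ A) k₂ (c₁ ++ c₂)
  r-nbox  : ∀ {k k' x A c} →
            T (suc k) (new k) (neg A) k' c →
            T k x (~ □ A) k' (evC [ pos x ] (pos (new k)) ∷ c)
  r-dia   : ∀ {k k' x A c} → lit A ≡ nothing →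
            T (suc k) (new k) A k' c →
            T k x (◇ A) k' (evC [ pos x ] (pos (new k)) ∷ c)
  r-ndia  : ∀ {k k₁ k₂ x A c₁ c₂} →
            T (suc k) x (□ atom (new k)) k₁ c₁ → T k₁ (new k) (neg A) k₂ c₂ →
            T k x (~ ◇ A) k₂ (c₁ ++ c₂)
  r-untilL  : ∀ {k k₁ k₂ x A B c₁ c₂} → lit A ≡ nothing →
              T (suc k) x (atom (new k) 𝒰 B) k₁ c₁ → T k₁ (new k) A k₂ c₂ →
              T k x (A 𝒰 B) k₂ (c₁ ++ c₂)
  r-untilR  : ∀ {k k₁ k₂ x A B c₁ c₂} → lit B ≡ nothing →
              T (suc k) x (A 𝒰 atom (new k)) k₁ c₁ → T k₁ (new k) B k₂ c₂ →
              T k x (A 𝒰 B) k₂ (c₁ ++ c₂)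
  r-unlessL : ∀ {k k₁ k₂ x A B c₁ c₂} → lit A ≡ nothing →
              T (suc k) x (atom (new k) 𝒲 B) k₁ c₁ → T k₁ (new k) A k₂ c₂ →
              T k x (A 𝒲 B) k₂ (c₁ ++ c₂)
  r-unlessR : ∀ {k k₁ k₂ x A B c₁ c₂} → lit B ≡ nothing →
              T (suc k) x (A 𝒲 atom (new k)) k₁ c₁ → T k₁ (new k) B k₂ c₂ →
              T k x (A 𝒲 B) k₂ (c₁ ++ c₂)
  -- y = new k, z = new (k+1), v = new (k+2)
  r-nuntil  : ∀ {k k₁ k₂ k₃ k₄ x A B c₁ c₂ c₃ c₄} →
              T (3 + k) x (atom (new k) 𝒲 atom (new (2 + k))) k₁ c₁ →
              T k₁ (new k) (neg B) k₂ c₂ →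
              T k₂ (new (2 + k)) (atom (new k) ∧ᶠ atom (new (1 + k))) k₃ c₃ →
              T k₃ (new (1 + k)) (neg A) k₄ c₄ →
              T k x (~ (A 𝒰 B)) k₄ (c₁ ++ c₂ ++ c₃ ++ c₄)
  r-nunless : ∀ {k k₁ k₂ k₃ k₄ x A B c₁ c₂ c₃ c₄} →
              T (3 + k) x (atom (new k) 𝒰 atom (new (2 + k))) k₁ c₁ →
              T k₁ (new k) (neg B) k₂ c₂ →
              T k₂ (new (2 + k)) (atom (new k) ∧ᶠ atom (new (1 + k))) k₃ c₃ →
              T k₃ (new (1 + k)) (neg A) k₄ c₄ →
              T k x (~ (A 𝒲 B)) k₄ (c₁ ++ c₂ ++ c₃ ++ c₄)
  r-boxLit  : ∀ {k k₁ k₂ x A l c₁ c₂} → lit A ≡ just l →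
              T (suc k) x A k₁ c₁ → T k₁ x (atom (new k)) k₂ c₂ →
              T k x (□ A) k₂ (c₁ ++ c₂ ++
                 (stepC [ pos (new k) ] (lits [ l ]) ∷
                  stepC [ pos (new k) ] (lits [ pos (new k) ]) ∷ []))
  r-untilLit : ∀ {k k₁ k₂ x A B l m c₁ c₂} → lit A ≡ just l → lit B ≡ just m →
              T (suc k) x (A ∨ᶠ B) k₁ c₁ → T k₁ x (atom (new k) ∨ᶠ B) k₂ c₂ →
              T k x (A 𝒰 B) k₂ (evC [ pos x ] m ∷ c₁ ++ c₂ ++
                 (stepC [ pos (new k) ] (lits (l ∷ m ∷ [])) ∷
                  stepC [ pos (new k) ] (lits (pos (new k) ∷ m ∷ [])) ∷ []))
  r-unlessLit : ∀ {k k₁ k₂ x A B l m c₁ c₂} → lit A ≡ just l → lit B ≡ just m →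
              T (suc k) x (A ∨ᶠ B) k₁ c₁ → T k₁ x (atom (new k) ∨ᶠ B) k₂ c₂ →
              T k x (A 𝒲 B) k₂ (c₁ ++ c₂ ++
                 (stepC [ pos (new k) ] (lits (l ∷ m ∷ [])) ∷
                  stepC [ pos (new k) ] (lits (pos (new k) ∷ m ∷ [])) ∷ []))
  -- (4)  (∨ taken up to commutativity)
  r-orR : ∀ {k k₁ k₂ x D A c₁ c₂} → ldisj A ≡ nothing →
          T (suc k) x (D ∨ᶠ atom (new k)) k₁ c₁ → T k₁ (new k) A k₂ c₂ →
          T k x (D ∨ᶠ A) k₂ (c₁ ++ c₂)
  r-orL : ∀ {k k₁ k₂ x D A c₁ c₂} → ldisj A ≡ nothing →
          T (suc k) x (atom (new k) ∨ᶠ D) k₁ c₁ → T k₁ (new k) A k₂ c₂ →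
          T k x (A ∨ᶠ D) k₂ (c₁ ++ c₂)
  r-disj  : ∀ {k x D ls} → ldisj D ≡ just ls →
            T k x D k (initC (lits (ngt x ∷ ls)) ∷ stepC [] (lits (ngt x ∷ ls)) ∷ [])
  r-true  : ∀ {k x} → T k x ⊤ᶠ k (initC ⊤ʳ ∷ stepC [] ⊤ʳ ∷ [])
  r-false : ∀ {k x} →
            T k x ⊥ᶠ k (initC (lits [ ngt x ]) ∷ stepC [] (lits [ ngt x ]) ∷ [])
  r-diaLit  : ∀ {k x A l} → lit A ≡ just l → T k x (◇ A) k (evC [ pos x ] l ∷ [])
  r-nextLit : ∀ {k x A ls} → ldisj A ≡ just ls →
              T k x (○ A) k (stepC [ pos x ] (lits ls) ∷ [])

-- Length.  len A, and lenN A = len(¬A).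

ifJust : ∀ {X : Set} → Maybe X → ℕ → ℕ → ℕ
ifJust (just _) a b = a
ifJust nothing  a b = b

mutual
  len : Fm → ℕ
  len (atom _) = 1
  len ⊤ᶠ = 1
  len ⊥ᶠ = 1
  len (~ A) = lenN A
  len (A ∨ᶠ B) = ifJust (ldisj (A ∨ᶠ B)) 1 (1 + len A + len B)
  len (A ∧ᶠ B) = 1 + len A + len B
  len (A ⇒ᶠ B) = 1 + lenN A + len B
  len (○ A) = ifJust (ldisj A) 1 (1 + len A)
  len (□ A) = 1 + len A
  len (◇ A) = ifJust (lit A) 1 (1 + len A)
  len (A 𝒰 B) = 1 + len A + len B
  len (A 𝒲 B) = 1 + len A + len B

  lenN : Fm → ℕ
  lenN (atom _) = 1
  lenN ⊤ᶠ = 1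
  lenN ⊥ᶠ = 1
  lenN (~ A) = len A
  lenN (A ∨ᶠ B) = 1 + lenN A + lenN B
  lenN (A ∧ᶠ B) = 1 + lenN A + lenN B
  lenN (A ⇒ᶠ B) = 1 + len A + lenN B
  lenN (○ A) = 1 + lenN A
  lenN (□ A) = 1 + lenN A
  lenN (◇ A) = 1 + lenN A
  lenN (A 𝒰 B) = 1 + lenN A + lenN B
  lenN (A 𝒲 B) = 1 + lenN A + lenN B

-- Give every formula A a clause budget (budgetN A for ¬A) that mirrors the rewrite rules: each
-- rule emits a fixed number of clauses of its own and recurses only into the subformulae it
-- renames, so every τ₁-derivation for x ⇒ A yields at most budget A clauses, whichever rules
-- are chosen.  A rule's own share never exceeds 11 (attained by ¬(A 𝒰 B) and ¬(A 𝒲 B)) and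
-- each rule application is paid for by its own unit of len, so budget A ≤ 11 · len A.
module Submission where

open import Defs
open import Data.Nat using (ℕ; _≤_; _*_; _+_; z≤n; s≤s)
open import Data.Nat.Properties
  using ( ≤-refl; ≤-reflexive; ≤-trans; +-mono-≤; +-monoʳ-≤; +-monoˡ-≤; m≤m+n; n≤1+n
        ; +-comm; +-commutativeSemigroup; +-identityʳ; *-distribˡ-+; module ≤-Reasoning)
open import Data.List using (List; length; _++_; []; _∷_; [_])
open import Data.List.Properties using (length-++)
open import Data.Maybe using (Maybe; just; nothing)
open import Relation.Binary.PropositionalEquality using (_≡_; refl; sym; cong; module ≡-Reasoning)
open import Algebra.Properties.CommutativeSemigroup +-commutativeSemigroup using (xy∙z≈xz∙y)

-- The cost b of a subformula is paid only if τ₁ renames it by a fresh symbol, i.e. unless m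
-- (its `lit` or `ldisj`) shows that it can stay in place.
ifRenamed : ∀ {X : Set} → Maybe X → ℕ → ℕ
ifRenamed m b = ifJust m 0 b

ifRenamed-≤ : ∀ {X : Set} (m : Maybe X) {a b} → a ≤ b → ifRenamed m a ≤ b
ifRenamed-≤ (just _) _ = z≤n
ifRenamed-≤ nothing a≤b = a≤b

ifRenamed-mono : ∀ {X : Set} (m : Maybe X) {a b} → a ≤ b → ifRenamed m a ≤ ifRenamed m b
ifRenamed-mono (just _) _ = z≤n
ifRenamed-mono nothing a≤b = a≤b

mutual
  budget : Fm → ℕ
  budget (atom _) = 2
  budget ⊤ᶠ = 2
  budget ⊥ᶠ = 2
  budget (~ A) = budgetN A
  budget (A ∨ᶠ B) = 2 + ifRenamed (ldisj A) (budget A) + ifRenamed (ldisj B) (budget B)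
  budget (A ∧ᶠ B) = budget A + budget B
  budget (A ⇒ᶠ B) = 2 + ifRenamed (ldisj (neg A)) (budgetN A) + ifRenamed (ldisj B) (budget B)
  budget (○ A) = 1 + ifRenamed (ldisj A) (budget A)
  budget (□ A) = ifJust (lit A) 6 (6 + budget A)
  budget (◇ A) = 1 + ifRenamed (lit A) (budget A)
  budget (A 𝒰 B) = 7 + ifRenamed (lit A) (budget A) + ifRenamed (lit B) (budget B)
  budget (A 𝒲 B) = 7 + ifRenamed (lit A) (budget A) + ifRenamed (lit B) (budget B)

  budgetN : Fm → ℕ
  budgetN (atom _) = 2
  budgetN ⊤ᶠ = 2
  budgetN ⊥ᶠ = 2
  budgetN (~ A) = budget A
  budgetN (A ∨ᶠ B) = budgetN A + budgetN B
  budgetN (A ∧ᶠ B) =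
    2 + ifRenamed (ldisj (neg A)) (budgetN A) + ifRenamed (ldisj (neg B)) (budgetN B)
  budgetN (A ⇒ᶠ B) = budget A + budgetN B
  budgetN (○ A) = 1 + budgetN A
  budgetN (□ A) = 1 + budgetN A
  budgetN (◇ A) = 6 + budgetN A
  budgetN (A 𝒰 B) = 11 + budgetN A + budgetN B
  budgetN (A 𝒲 B) = 11 + budgetN A + budgetN B

budget-neg≤budgetN : ∀ A → budget (neg A) ≤ budgetN A
budget-neg≤budgetN (atom _) = ≤-refl
budget-neg≤budgetN ⊤ᶠ = ≤-refl
budget-neg≤budgetN ⊥ᶠ = ≤-refl
budget-neg≤budgetN (~ _) = ≤-refl
budget-neg≤budgetN (_ ∨ᶠ _) = ≤-refl
budget-neg≤budgetN (_ ∧ᶠ _) = ≤-refl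
budget-neg≤budgetN (_ ⇒ᶠ _) = ≤-refl
budget-neg≤budgetN (○ _) = ≤-refl
budget-neg≤budgetN (□ _) = ≤-refl
budget-neg≤budgetN (◇ _) = ≤-refl
budget-neg≤budgetN (_ 𝒰 _) = ≤-refl
budget-neg≤budgetN (_ 𝒲 _) = ≤-refl

budget-neg∨≤budget-⇒ : ∀ A B → budget (neg A ∨ᶠ B) ≤ budget (A ⇒ᶠ B)
budget-neg∨≤budget-⇒ A B = +-monoˡ-≤ (ifRenamed (ldisj B) (budget B))
  (+-monoʳ-≤ 2 (ifRenamed-mono (ldisj (neg A)) (budget-neg≤budgetN A)))

budget-neg∨neg≤budgetN-∧ : ∀ A B → budget (neg A ∨ᶠ neg B) ≤ budgetN (A ∧ᶠ B)
budget-neg∨neg≤budgetN-∧ A B = +-mono-≤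
  (+-monoʳ-≤ 2 (ifRenamed-mono (ldisj (neg A)) (budget-neg≤budgetN A)))
  (ifRenamed-mono (ldisj (neg B)) (budget-neg≤budgetN B))

lit⇒ldisj : ∀ A {l} → lit A ≡ just l → ldisj A ≡ just [ l ]
lit⇒ldisj (atom _) refl = refl
lit⇒ldisj (~ atom _) refl = refl

ldisj-∨ : ∀ A B {as bs} → ldisj A ≡ just as → ldisj B ≡ just bs →
          ldisj (A ∨ᶠ B) ≡ just (as ++ bs)
ldisj-∨ A B eA eB rewrite eA | eB = refl

ldisj⇒budget≡2 : ∀ D {ls} → ldisj D ≡ just ls → budget D ≡ 2
ldisj⇒budget≡2 (atom _) _ = refl
ldisj⇒budget≡2 (~ atom _) _ = refl
ldisj⇒budget≡2 (A ∨ᶠ B) _ with ldisj A | ldisj B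
... | just _ | just _ = refl

length-++-≤ : ∀ {X : Set} (xs : List X) {ys : List X} {m n} →
              length xs ≤ m → length ys ≤ n → length (xs ++ ys) ≤ m + n
length-++-≤ xs p q = ≤-trans (≤-reflexive (length-++ xs)) (+-mono-≤ p q)

renamingˡ-≤ : ∀ c (xs : List Clause) {ys : List Clause} {a b} →
              length xs ≤ c + 0 + b → length ys ≤ a → length (xs ++ ys) ≤ c + a + b
renamingˡ-≤ c xs {a = a} {b} p q = ≤-trans (length-++-≤ xs p q) (≤-reflexive (begin
  c + 0 + b + a  ≡⟨ cong (λ n → n + b + a) (+-identityʳ c) ⟩
  c + b + a      ≡⟨ xy∙z≈xz∙y c b a ⟩
  c + a + b      ∎))
  where open ≡-Reasoning

renamingʳ-≤ : ∀ c (xs : List Clause) {ys : List Clause} {a b} →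
              length xs ≤ c + a + 0 → length ys ≤ b → length (xs ++ ys) ≤ c + a + b
renamingʳ-≤ c xs {a = a} {b} p q =
  ≤-trans (length-++-≤ xs p q) (≤-reflexive (cong (_+ b) (+-identityʳ (c + a))))

negatedUntil-≤ : ∀ (c₁ c₂ c₃ : List Clause) {c₄ : List Clause} {a b} →
                 length c₁ ≤ 7 → length c₂ ≤ b → length c₃ ≤ 4 → length c₄ ≤ a →
                 length (c₁ ++ c₂ ++ c₃ ++ c₄) ≤ 11 + a + b
negatedUntil-≤ c₁ c₂ c₃ {a = a} {b} p q r t =
  ≤-trans (length-++-≤ c₁ p (length-++-≤ c₂ q (length-++-≤ c₃ r t)))
          (≤-reflexive (cong (7 +_) (+-comm b (4 + a))))

mutual
  length≤budget : ∀ {k x A k' cs} → T k x A k' cs → length cs ≤ budget A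
  length≤budget (r-and {c₁ = c₁} p q) = length-++-≤ c₁ (length≤budget p) (length≤budget q)
  length≤budget (r-imp {A = A} {B} p) = ≤-trans (length≤budget p) (budget-neg∨≤budget-⇒ A B)
  length≤budget (r-nand {A = A} {B} p) =
    ≤-trans (length≤budget p) (budget-neg∨neg≤budgetN-∧ A B)
  length≤budget (r-nimp {B = B} {c₁ = c₁} p q) =
    length-++-≤ c₁ (length≤budget p) (length≤budgetN B q)
  length≤budget (r-nor {A = A} {B} {c₁ = c₁} p q) =
    length-++-≤ c₁ (length≤budgetN A p) (length≤budgetN B q)
  length≤budget (r-next e p) rewrite e = s≤s (length≤budget p)
  length≤budget (r-nnext {A = A} p) = s≤s (length≤budgetN A p)
  length≤budget (r-box {c₁ = c₁} e p q) rewrite e =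
    length-++-≤ c₁ (length≤budget p) (length≤budget q)
  length≤budget (r-nbox {A = A} p) = s≤s (length≤budgetN A p)
  length≤budget (r-dia e p) rewrite e = s≤s (length≤budget p)
  length≤budget (r-ndia {A = A} {c₁ = c₁} p q) =
    length-++-≤ c₁ (length≤budget p) (length≤budgetN A q)
  length≤budget (r-untilL {c₁ = c₁} e p q) rewrite e =
    renamingˡ-≤ 7 c₁ (length≤budget p) (length≤budget q)
  length≤budget (r-untilR {c₁ = c₁} e p q) rewrite e =
    renamingʳ-≤ 7 c₁ (length≤budget p) (length≤budget q)
  length≤budget (r-unlessL {c₁ = c₁} e p q) rewrite e =
    renamingˡ-≤ 7 c₁ (length≤budget p) (length≤budget q)
  length≤budget (r-unlessR {c₁ = c₁} e p q) rewrite e =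
    renamingʳ-≤ 7 c₁ (length≤budget p) (length≤budget q)
  length≤budget (r-nuntil {A = A} {B} {c₁ = c₁} {c₂} {c₃} p q r t) = negatedUntil-≤ c₁ c₂ c₃
    (length≤budget p) (length≤budgetN B q) (length≤budget r) (length≤budgetN A t)
  length≤budget (r-nunless {A = A} {B} {c₁ = c₁} {c₂} {c₃} p q r t) = negatedUntil-≤ c₁ c₂ c₃
    (length≤budget p) (length≤budgetN B q) (length≤budget r) (length≤budgetN A t)
  length≤budget (r-boxLit {A = A} {c₁ = c₁} {c₂} e p q) rewrite e =
    length-++-≤ c₁ (ldisj⇒length≤2 (lit⇒ldisj A e) p) (length-++-≤ c₂ (length≤budget q) ≤-refl)
  length≤budget (r-untilLit {A = A} {B} {c₁ = c₁} {c₂} eA eB p q) rewrite eA | eB =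
    s≤s (literalUntil-≤6 A B c₁ c₂ eA eB p q)
  length≤budget (r-unlessLit {A = A} {B} {c₁ = c₁} {c₂} eA eB p q) rewrite eA | eB =
    ≤-trans (literalUntil-≤6 A B c₁ c₂ eA eB p q) (n≤1+n 6)
  length≤budget (r-orR {c₁ = c₁} e p q) rewrite e =
    renamingʳ-≤ 2 c₁ (length≤budget p) (length≤budget q)
  length≤budget (r-orL {c₁ = c₁} e p q) rewrite e =
    renamingˡ-≤ 2 c₁ (length≤budget p) (length≤budget q)
  length≤budget (r-disj {D = D} e) = ≤-reflexive (sym (ldisj⇒budget≡2 D e))
  length≤budget r-true = ≤-refl
  length≤budget r-false = ≤-refl
  length≤budget (r-diaLit e) rewrite e = ≤-refl
  length≤budget (r-nextLit e) rewrite e = ≤-refl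

  length≤budgetN : ∀ A {k x k' cs} → T k x (neg A) k' cs → length cs ≤ budgetN A
  length≤budgetN A d = ≤-trans (length≤budget d) (budget-neg≤budgetN A)

  ldisj⇒length≤2 : ∀ {k x D k' cs ls} → ldisj D ≡ just ls → T k x D k' cs → length cs ≤ 2
  ldisj⇒length≤2 {D = D} e d = ≤-trans (length≤budget d) (≤-reflexive (ldisj⇒budget≡2 D e))

  literalUntil-≤6 : ∀ A B (c₁ c₂ : List Clause) {k k₁ k₂ x y l m} {γ δ : Clause} →
                    lit A ≡ just l → lit B ≡ just m →
                    T k x (A ∨ᶠ B) k₁ c₁ → T k₁ x (atom y ∨ᶠ B) k₂ c₂ →
                    length (c₁ ++ c₂ ++ γ ∷ δ ∷ []) ≤ 6
  literalUntil-≤6 A B c₁ c₂ eA eB p q = length-++-≤ c₁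
    (ldisj⇒length≤2 (ldisj-∨ A B (lit⇒ldisj A eA) (lit⇒ldisj B eB)) p)
    (length-++-≤ c₂ (ldisj⇒length≤2 (ldisj-∨ (atom _) B refl (lit⇒ldisj B eB)) q) ≤-refl)

unary-≤ : ∀ c L {a} → c ≤ 11 → a ≤ 11 * L → c + a ≤ 11 * (1 + L)
unary-≤ c L c≤11 a≤11L =
  ≤-trans (+-mono-≤ c≤11 a≤11L) (≤-reflexive (sym (*-distribˡ-+ 11 1 L)))

binary-≤ : ∀ c L M {a b} → c ≤ 11 → a ≤ 11 * L → b ≤ 11 * M → c + a + b ≤ 11 * (1 + L + M)
binary-≤ c L M {a} {b} c≤11 a≤11L b≤11M = begin
  c + a + b              ≤⟨ +-mono-≤ (unary-≤ c L c≤11 a≤11L) b≤11M ⟩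
  11 * (1 + L) + 11 * M  ≡⟨ sym (*-distribˡ-+ 11 (1 + L) M) ⟩
  11 * (1 + L + M)       ∎
  where open ≤-Reasoning

mutual
  budget≤11*len : ∀ A → budget A ≤ 11 * len A
  budget≤11*len (atom _) = m≤m+n 2 9
  budget≤11*len ⊤ᶠ = m≤m+n 2 9
  budget≤11*len ⊥ᶠ = m≤m+n 2 9
  budget≤11*len (~ A) = budgetN≤11*lenN A
  budget≤11*len (A ∨ᶠ B) with ldisj A | ldisj B
  ... | just _ | just _ = m≤m+n 2 9
  ... | just _ | nothing = binary-≤ 2 (len A) (len B) {a = 0} (m≤m+n 2 9) z≤n (budget≤11*len B)
  ... | nothing | mB = binary-≤ 2 (len A) (len B) (m≤m+n 2 9)
    (budget≤11*len A) (ifRenamed-≤ mB (budget≤11*len B))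
  budget≤11*len (A ∧ᶠ B) = binary-≤ 0 (len A) (len B) z≤n (budget≤11*len A) (budget≤11*len B)
  budget≤11*len (A ⇒ᶠ B) = binary-≤ 2 (lenN A) (len B) (m≤m+n 2 9)
    (ifRenamed-≤ (ldisj (neg A)) (budgetN≤11*lenN A)) (ifRenamed-≤ (ldisj B) (budget≤11*len B))
  budget≤11*len (○ A) with ldisj A
  ... | just _ = m≤m+n 1 10
  ... | nothing = unary-≤ 1 (len A) (m≤m+n 1 10) (budget≤11*len A)
  budget≤11*len (□ A) with lit A
  ... | just _ = unary-≤ 6 (len A) {a = 0} (m≤m+n 6 5) z≤n
  ... | nothing = unary-≤ 6 (len A) (m≤m+n 6 5) (budget≤11*len A)
  budget≤11*len (◇ A) with lit A
  ... | just _ = m≤m+n 1 10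
  ... | nothing = unary-≤ 1 (len A) (m≤m+n 1 10) (budget≤11*len A)
  budget≤11*len (A 𝒰 B) = binary-≤ 7 (len A) (len B) (m≤m+n 7 4)
    (ifRenamed-≤ (lit A) (budget≤11*len A)) (ifRenamed-≤ (lit B) (budget≤11*len B))
  budget≤11*len (A 𝒲 B) = binary-≤ 7 (len A) (len B) (m≤m+n 7 4)
    (ifRenamed-≤ (lit A) (budget≤11*len A)) (ifRenamed-≤ (lit B) (budget≤11*len B))

  budgetN≤11*lenN : ∀ A → budgetN A ≤ 11 * lenN A
  budgetN≤11*lenN (atom _) = m≤m+n 2 9
  budgetN≤11*lenN ⊤ᶠ = m≤m+n 2 9
  budgetN≤11*lenN ⊥ᶠ = m≤m+n 2 9
  budgetN≤11*lenN (~ A) = budget≤11*len A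
  budgetN≤11*lenN (A ∨ᶠ B) =
    binary-≤ 0 (lenN A) (lenN B) z≤n (budgetN≤11*lenN A) (budgetN≤11*lenN B)
  budgetN≤11*lenN (A ∧ᶠ B) = binary-≤ 2 (lenN A) (lenN B) (m≤m+n 2 9)
    (ifRenamed-≤ (ldisj (neg A)) (budgetN≤11*lenN A))
    (ifRenamed-≤ (ldisj (neg B)) (budgetN≤11*lenN B))
  budgetN≤11*lenN (A ⇒ᶠ B) =
    binary-≤ 0 (len A) (lenN B) z≤n (budget≤11*len A) (budgetN≤11*lenN B)
  budgetN≤11*lenN (○ A) = unary-≤ 1 (lenN A) (m≤m+n 1 10) (budgetN≤11*lenN A)
  budgetN≤11*lenN (□ A) = unary-≤ 1 (lenN A) (m≤m+n 1 10) (budgetN≤11*lenN A)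
  budgetN≤11*lenN (◇ A) = unary-≤ 6 (lenN A) (m≤m+n 6 5) (budgetN≤11*lenN A)
  budgetN≤11*lenN (A 𝒰 B) =
    binary-≤ 11 (lenN A) (lenN B) ≤-refl (budgetN≤11*lenN A) (budgetN≤11*lenN B)
  budgetN≤11*lenN (A 𝒲 B) =
    binary-≤ 11 (lenN A) (lenN B) ≤-refl (budgetN≤11*lenN A) (budgetN≤11*lenN B)

lemma12 : (x : ℕ) (W : Fm) → Orig W →
    ∀ {k : ℕ} {cs : List Clause} →
    T 0 (orig x) (simp W) k cs →
    length cs ≤ 11 * len (simp W)
lemma12 x W _ d = ≤-trans (length≤budget d) (budget≤11*len (simp W))
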